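{- Let $G$ be a snark with $\pi(G)\ge5$. Then no apex of $G$ is incident with a pair of parallel edges.
   Context: Graphs are finite; multiple edges and loops permitted. A snark is a $2$-connected cubic graph with no proper $3$-edge-colouring. $\pi(G)$ is the minimum number of perfect matchings of $G$ whose union is $E(G)$. A vertex $v$ of a snark $G$ is an apex if the graph $G^v$ obtained by inflating $v$ to a triangle (replace $v$ by three mutually adjacent new vertices and re-attach the three edges formerly at $v$ to distinct new vertices) has $\pi(G^v)=4$. -}

module Defs where

open import Data.Nat using (ℕ; zero; suc; _+_; _*_; _<_; _≤_)
open import Data.Nat.Properties using (_<?_)
open import Data.Fin using (Fin; zero; suc; toℕ) renaming (_≟_ to _≟F_)
open import Data.Bool using (Bool; true; false; _∧_; if_then_else_)
open import Data.List using (List; []; _∷_; allFin; cartesianProduct)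
open import Data.Product using (Σ; ∃; _×_; _,_; proj₁; proj₂)
open import Data.Sum using (_⊎_)
open import Data.Unit using (⊤)
open import Relation.Nullary using (¬_; does)
open import Relation.Binary.PropositionalEquality using (_≡_; _≢_)

-- A finite multigraph (multiple edges and loops allowed):
-- vertices Fin n, edges Fin m, each edge has two ends (end e zero, end e (suc zero)).
-- A loop is an edge whose two ends coincide.
record Graph : Set where
  field
    n   : ℕ
    m   : ℕ
    end : Fin m → Fin 2 → Fin n

open Graph public

Vtx : Graph → Set
Vtx G = Fin (n G)

Edge : Graph → Set
Edge G = Fin (m G)

count : {A : Set} → (A → Bool) → List A → ℕ
count p [] = 0
count p (x ∷ xs) = if p x then suc (count p xs) else count p xs

darts : (k : ℕ) → List (Fin k × Fin 2)
darts k = cartesianProduct (allFin k) (allFin 2)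

-- degree of v in the spanning subgraph with edge set S (loops count twice)
degIn : (G : Graph) → (Edge G → Bool) → Vtx G → ℕ
degIn G S v = count (λ d → S (proj₁ d) ∧ does (end G (proj₁ d) (proj₂ d) ≟F v)) (darts (m G))

deg : (G : Graph) → Vtx G → ℕ
deg G v = degIn G (λ _ → true) v

Cubic : Graph → Set
Cubic G = ∀ v → deg G v ≡ 3

data Reach (G : Graph) (P : Vtx G → Set) (u : Vtx G) : Vtx G → Set where
  here : P u → Reach G P u u
  step : ∀ {w x} → Reach G P u w → (e : Edge G) → (i j : Fin 2) →
         i ≢ j → end G e i ≡ w → end G e j ≡ x → P x → Reach G P u x

ConnectedOn : (G : Graph) → (Vtx G → Set) → Set
ConnectedOn G P = ∀ u w → P u → P w → Reach G P u w

TwoConnected : Graph → Set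
TwoConnected G = (3 ≤ n G) × ConnectedOn G (λ _ → ⊤) × (∀ v → ConnectedOn G (λ x → x ≢ v))

Proper3 : (G : Graph) → (Edge G → Fin 3) → Set
Proper3 G c = (∀ e → end G e zero ≢ end G e (suc zero)) ×
              (∀ e f i j → e ≢ f → end G e i ≡ end G f j → c e ≢ c f)

Colourable3 : Graph → Set
Colourable3 G = Σ (Edge G → Fin 3) (Proper3 G)

Snark : Graph → Set
Snark G = Cubic G × TwoConnected G × ¬ Colourable3 G

PerfectMatching : (G : Graph) → (Edge G → Bool) → Set
PerfectMatching G M = ∀ v → degIn G M v ≡ 1

Cover : Graph → ℕ → Set
Cover G k = Σ (Fin k → Edge G → Bool) λ Ms →
              (∀ j → PerfectMatching G (Ms j)) × (∀ e → ∃ λ j → Ms j e ≡ true)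

-- π(G) ≥ k  (minimum over an empty set taken to be ∞)
PiAtLeast : Graph → ℕ → Set
PiAtLeast G k = ∀ j → j < k → ¬ Cover G j

PiIs : Graph → ℕ → Set
PiIs G k = Cover G k × PiAtLeast G k

-- inflating a vertex v into a triangle.
-- New vertices: zero (=t1), suc zero (=t2), suc (suc x) (= old x; t0 = suc (suc v)).
-- New edges: three triangle edges, then the old edges (suc (suc (suc e))).
-- The three darts formerly at v are attached to t0, t1, t2 according to their
-- rank (in the order of (edge, side)) among the darts at v.
module Inflate (G : Graph) (v : Vtx G) where
  N : ℕ
  N = suc (suc (n G))

  old : Vtx G → Fin N
  old x = suc (suc x)

  t : ℕ → Fin N
  t 0 = old v
  t 1 = zero
  t _ = suc zero

  idx : Edge G → Fin 2 → ℕ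
  idx e i = toℕ e * 2 + toℕ i

  rank : Edge G → Fin 2 → ℕ
  rank e i = count (λ d → does (end G (proj₁ d) (proj₂ d) ≟F v) ∧
                          does (idx (proj₁ d) (proj₂ d) <? idx e i)) (darts (m G))

  end' : Fin (3 + m G) → Fin 2 → Fin N
  end' zero zero = t 0
  end' zero (suc zero) = t 1
  end' (suc zero) zero = t 1
  end' (suc zero) (suc zero) = t 2
  end' (suc (suc zero)) zero = t 2
  end' (suc (suc zero)) (suc zero) = t 0
  end' (suc (suc (suc e))) i =
    if does (end G e i ≟F v) then t (rank e i) else old (end G e i)

inflate : (G : Graph) → Vtx G → Graph
inflate G v = record { n = Inflate.N G v ; m = 3 + m G ; end = Inflate.end' G v }

Apex : (G : Graph) → Vtx G → Set
Apex G v = PiIs (inflate G v) 4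

Incident : (G : Graph) → Vtx G → Edge G → Set
Incident G v e = (end G e zero ≡ v) ⊎ (end G e (suc zero) ≡ v)

Parallel : (G : Graph) → Edge G → Edge G → Set
Parallel G e f = e ≢ f ×
  ((end G e zero ≡ end G f zero × end G e (suc zero) ≡ end G f (suc zero)) ⊎
   (end G e zero ≡ end G f (suc zero) × end G e (suc zero) ≡ end G f zero))

-- A perfect matching M of G^v meets the triangle in k edges and the three edges
-- formerly at v in d edges; counting the ends at the triangle gives 2k + d = 3, so
-- d ∈ {1, 3}, while at every other vertex M and its restriction to E(G) agree.
-- If d = 3, both edges of the digon vu lie in M and u would be covered twice.
-- So restriction maps perfect matchings of G^v to perfect matchings of G, and a
-- cover of G^v by four of them restricts to a cover of G, contradicting π(G) ≥ 5.
module Submission where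

open import Defs
open import Data.Bool using (Bool; true; false; _∧_; not; if_then_else_)
open import Data.Bool.Properties using (∧-zeroʳ; ∧-identityʳ)
open import Data.Empty using (⊥-elim)
open import Data.Fin using (Fin; zero; suc; _↑ˡ_; _↑ʳ_) renaming (_≟_ to _≟F_)
open import Data.List using (List; []; _∷_; _++_; map; length; allFin; cartesianProduct)
open import Data.List.Membership.Propositional using (_∈_)
open import Data.List.Membership.Propositional.Properties using (∈-cartesianProduct⁺; ∈-allFin)
open import Data.List.Properties using (map-++; map-∘; map-tabulate)
open import Data.List.Relation.Unary.All as All using (All; []; _∷_)
open import Data.List.Relation.Unary.AllPairs using ([]; _∷_)
open import Data.List.Relation.Unary.Any using (here; there)
open import Data.List.Relation.Unary.Unique.Propositional using (Unique)
open import Data.Nat using (ℕ; zero; suc; _+_; _*_; _≤_; z≤n; s≤s)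
open import Data.Nat.Properties
  using (+-assoc; +-suc; ≤-trans; ≤-refl; +-mono-≤; m≤m+n; m≤n+m; m<m+n; <-irrefl; 1+n≰n; suc-injective; *-monoʳ-≤; n<1+n)
open import Data.Nat.Solver using (module +-*-Solver)
open import Data.Product using (Σ; ∃; _×_; _,_; proj₁; proj₂; map₁)
open import Data.Product.Properties using (≡-dec)
open import Data.Sum using (_⊎_; inj₁; inj₂)
open import Function using (_∘_)
open import Relation.Binary.Definitions using (DecidableEquality)
open import Relation.Binary.PropositionalEquality
open import Relation.Nullary using (¬_; Dec; yes; no; does; contradiction)
open import Relation.Nullary.Decidable using (dec-true; dec-false)

bit : Bool → ℕ
bit true = 1
bit false = 0

module _ {A : Set} where

  count-∷ : (p : A → Bool) (x : A) (xs : List A) → count p (x ∷ xs) ≡ bit (p x) + count p xs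
  count-∷ p x xs with p x
  ... | true = refl
  ... | false = refl

  count-++ : (p : A → Bool) (xs ys : List A) → count p (xs ++ ys) ≡ count p xs + count p ys
  count-++ p [] ys = refl
  count-++ p (x ∷ xs) ys = begin
    count p (x ∷ xs ++ ys)               ≡⟨ count-∷ p x (xs ++ ys) ⟩
    bit (p x) + count p (xs ++ ys)       ≡⟨ cong (bit (p x) +_) (count-++ p xs ys) ⟩
    bit (p x) + (count p xs + count p ys) ≡⟨ +-assoc (bit (p x)) _ _ ⟨
    bit (p x) + count p xs + count p ys  ≡⟨ cong (_+ count p ys) (count-∷ p x xs) ⟨
    count p (x ∷ xs) + count p ys        ∎
    where open ≡-Reasoning

  count-cong : {p q : A → Bool} → p ≗ q → count p ≗ count q
  count-cong p≗q [] = refl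
  count-cong {p} {q} p≗q (x ∷ xs)
    rewrite count-∷ p x xs | count-∷ q x xs | p≗q x | count-cong p≗q xs = refl

  count-split : (p q : A → Bool) (xs : List A) →
    count p xs ≡ count (λ x → q x ∧ p x) xs + count (λ x → not (q x) ∧ p x) xs
  count-split p q [] = refl
  count-split p q (x ∷ xs) with q x | p x
  ... | true  | true  = cong suc (count-split p q xs)
  ... | true  | false = count-split p q xs
  ... | false | true  = trans (cong suc (count-split p q xs)) (sym (+-suc _ _))
  ... | false | false = count-split p q xs

  count-+₃ : {p q r s : A → Bool} → (∀ x → bit (p x) + bit (q x) + bit (r x) ≡ bit (s x)) →
    (xs : List A) → count p xs + count q xs + count r xs ≡ count s xs
  count-+₃ h [] = refl
  count-+₃ {p} {q} {r} {s} h (x ∷ xs)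
    rewrite count-∷ p x xs | count-∷ q x xs | count-∷ r x xs | count-∷ s x xs =
    trans (interchange (bit (p x)) (bit (q x)) (bit (r x)) _ _ _) (cong₂ _+_ (h x) (count-+₃ h xs))
    where
    open +-*-Solver
    interchange : ∀ a b c a′ b′ c′ → (a + a′) + (b + b′) + (c + c′) ≡ (a + b + c) + (a′ + b′ + c′)
    interchange = solve 6 (λ a b c a′ b′ c′ →
      (a :+ a′) :+ (b :+ b′) :+ (c :+ c′) := (a :+ b :+ c) :+ (a′ :+ b′ :+ c′)) refl

  count-∈ : {p : A → Bool} {x : A} {xs : List A} → x ∈ xs → p x ≡ true → 1 ≤ count p xs
  count-∈ {p} {xs = y ∷ ys} (here refl) px rewrite count-∷ p y ys | px = s≤s z≤n
  count-∈ {p} {xs = y ∷ ys} (there x∈ys) px rewrite count-∷ p y ys =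
    ≤-trans (count-∈ x∈ys px) (m≤n+m _ (bit (p y)))

  module _ (_≟_ : DecidableEquality A) where

    count-remove : (p : A → Bool) {x : A} {xs : List A} → x ∈ xs → p x ≡ true →
      suc (count (λ y → not (does (y ≟ x)) ∧ p y) xs) ≤ count p xs
    count-remove p {x} {xs} x∈xs px =
      subst (suc (count (λ y → not (does (y ≟ x)) ∧ p y) xs) ≤_)
        (sym (count-split p (λ y → does (y ≟ x)) xs))
        (+-mono-≤ (count-∈ x∈xs (cong₂ _∧_ (dec-true (x ≟ x) refl) px)) ≤-refl)

    length≤count : (p : A → Bool) {xs : List A} (ys : List A) → Unique ys →
      All (_∈ xs) ys → All (λ y → p y ≡ true) ys → length ys ≤ count p xs
    length≤count p [] [] [] [] = z≤n
    length≤count p (y ∷ ys) (y∉ys ∷ uniq) (y∈xs ∷ ys⊆xs) (py ∷ pys) =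
      ≤-trans (s≤s (length≤count (λ z → not (does (z ≟ y)) ∧ p z) ys uniq ys⊆xs
                      (All.zipWith (λ (y≢z , pz) → cong₂ _∧_ (cong not (dec-false (_ ≟ y) (y≢z ∘ sym))) pz)
                         (y∉ys , pys))))
              (count-remove p y∈xs py)

count-map : {A B : Set} (p : B → Bool) (f : A → B) (xs : List A) → count p (map f xs) ≡ count (p ∘ f) xs
count-map p f [] = refl
count-map p f (x ∷ xs)
  rewrite count-∷ p (f x) (map f xs) | count-∷ (p ∘ f) x xs | count-map p f xs = refl

cartesianProduct-map₁ : {A B C : Set} (f : A → B) (xs : List A) (ys : List C) →
  cartesianProduct (map f xs) ys ≡ map (map₁ f) (cartesianProduct xs ys)
cartesianProduct-map₁ f [] ys = refl
cartesianProduct-map₁ f (x ∷ xs) ys = begin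
  map (f x ,_) ys ++ cartesianProduct (map f xs) ys
    ≡⟨ cong₂ _++_ (map-∘ ys) (cartesianProduct-map₁ f xs ys) ⟩
  map (map₁ f) (map (x ,_) ys) ++ map (map₁ f) (cartesianProduct xs ys)
    ≡⟨ map-++ (map₁ f) (map (x ,_) ys) _ ⟨
  map (map₁ f) (map (x ,_) ys ++ cartesianProduct xs ys) ∎
  where open ≡-Reasoning

count-darts-suc : (k : ℕ) (p : Fin (suc k) × Fin 2 → Bool) →
  count p (darts (suc k)) ≡ count (p ∘ (zero ,_)) (allFin 2) + count (p ∘ map₁ suc) (darts k)
count-darts-suc k p = begin
  count p (darts (suc k))
    ≡⟨ cong (λ fins → count p (map (zero ,_) (allFin 2) ++ cartesianProduct fins (allFin 2)))
            (sym (map-tabulate (λ i → i) suc)) ⟩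
  count p (map (zero ,_) (allFin 2) ++ cartesianProduct (map suc (allFin k)) (allFin 2))
    ≡⟨ count-++ p (map (zero ,_) (allFin 2)) (cartesianProduct (map suc (allFin k)) (allFin 2)) ⟩
  count p (map (zero ,_) (allFin 2)) + count p (cartesianProduct (map suc (allFin k)) (allFin 2))
    ≡⟨ cong₂ _+_ (count-map p (zero ,_) (allFin 2))
                 (trans (cong (count p) (cartesianProduct-map₁ suc (allFin k) (allFin 2)))
                        (count-map p (map₁ suc) (darts k))) ⟩
  count (p ∘ (zero ,_)) (allFin 2) + count (p ∘ map₁ suc) (darts k) ∎
  where open ≡-Reasoning

count-darts-+ : (j k : ℕ) (p : Fin (j + k) × Fin 2 → Bool) →
  count p (darts (j + k)) ≡ count (p ∘ map₁ (_↑ˡ k)) (darts j) + count (p ∘ map₁ (j ↑ʳ_)) (darts k)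
count-darts-+ zero k p = refl
count-darts-+ (suc j) k p = begin
  count p (darts (suc j + k))
    ≡⟨ count-darts-suc (j + k) p ⟩
  count (p ∘ (zero ,_)) (allFin 2) + count (p ∘ map₁ suc) (darts (j + k))
    ≡⟨ cong (count (p ∘ (zero ,_)) (allFin 2) +_) (count-darts-+ j k (p ∘ map₁ suc)) ⟩
  count (p ∘ (zero ,_)) (allFin 2) + (count (p ∘ map₁ (suc ∘ (_↑ˡ k))) (darts j)
                                       + count (p ∘ map₁ (suc j ↑ʳ_)) (darts k))
    ≡⟨ +-assoc (count (p ∘ (zero ,_)) (allFin 2)) _ _ ⟨
  count (p ∘ (zero ,_)) (allFin 2) + count (p ∘ map₁ (suc ∘ (_↑ˡ k))) (darts j)
    + count (p ∘ map₁ (suc j ↑ʳ_)) (darts k)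
    ≡⟨ cong (_+ count (p ∘ map₁ (suc j ↑ʳ_)) (darts k)) (count-darts-suc j (p ∘ map₁ (_↑ˡ k))) ⟨
  count (p ∘ map₁ (_↑ˡ k)) (darts (suc j)) + count (p ∘ map₁ (suc j ↑ʳ_)) (darts k) ∎
  where open ≡-Reasoning

module _ (G : Graph) where

  dart-∈ : (d : Edge G × Fin 2) → d ∈ darts (m G)
  dart-∈ (e , i) = ∈-cartesianProduct⁺ (∈-allFin e) (∈-allFin i)

  length≤degIn : (S : Edge G → Bool) (v : Vtx G) (ds : List (Edge G × Fin 2)) → Unique ds →
    All (λ d → S (proj₁ d) ≡ true × end G (proj₁ d) (proj₂ d) ≡ v) ds → length ds ≤ degIn G S v
  length≤degIn S v ds uniq at-v =
    length≤count (≡-dec _≟F_ _≟F_) _ ds uniq (All.universal dart-∈ ds)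
      (All.map (λ (S-e , e-v) → cong₂ _∧_ S-e (dec-true (_ ≟F v) e-v)) at-v)

  deg-split : (S : Edge G → Bool) (v : Vtx G) → deg G v ≡ degIn G S v + degIn G (not ∘ S) v
  deg-split S v = count-split _ (S ∘ proj₁) (darts (m G))

  saturated-contains : (S : Edge G → Bool) {v : Vtx G} → degIn G S v ≡ deg G v →
    ∀ {e i} → end G e i ≡ v → S e ≡ true
  saturated-contains S {v} saturated {e} {i} e-v with S e in S-e
  ... | true = refl
  ... | false = ⊥-elim (<-irrefl (trans saturated (deg-split S v)) (m<m+n (degIn G S v) e∉S))
    where
    e∉S : 1 ≤ degIn G (not ∘ S) v
    e∉S = length≤degIn (not ∘ S) v ((e , i) ∷ []) ([] ∷ []) ((cong not S-e , e-v) ∷ [])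

opp : Fin 2 → Fin 2
opp zero = suc zero
opp (suc zero) = zero

opp-≢ : (i : Fin 2) → i ≢ opp i
opp-≢ zero ()
opp-≢ (suc zero) ()

record Digon (G : Graph) (v u : Vtx G) : Set where
  constructor digon
  field
    {e f} : Edge G
    e≢f   : e ≢ f
    i j   : Fin 2
    e-v   : end G e i ≡ v
    f-v   : end G f j ≡ v
    e-u   : end G e (opp i) ≡ u
    f-u   : end G f (opp j) ≡ u

parallel⇒digon : (G : Graph) {v : Vtx G} {e f : Edge G} → Parallel G e f → Incident G v e → ∃ (Digon G v)
parallel⇒digon G (e≢f , inj₁ (e₀f₀ , e₁f₁)) (inj₁ e₀v) = _ , digon e≢f zero zero
  e₀v (trans (sym e₀f₀) e₀v) refl (sym e₁f₁)
parallel⇒digon G (e≢f , inj₂ (e₀f₁ , e₁f₀)) (inj₁ e₀v) = _ , digon e≢f zero (suc zero)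
  e₀v (trans (sym e₀f₁) e₀v) refl (sym e₁f₀)
parallel⇒digon G (e≢f , inj₁ (e₀f₀ , e₁f₁)) (inj₂ e₁v) = _ , digon e≢f (suc zero) (suc zero)
  e₁v (trans (sym e₁f₁) e₁v) refl (sym e₀f₀)
parallel⇒digon G (e≢f , inj₂ (e₀f₁ , e₁f₀)) (inj₂ e₁v) = _ , digon e≢f (suc zero) zero
  e₁v (trans (sym e₁f₀) e₁v) refl (sym e₀f₁)

module _ {G : Graph} {v u : Vtx G} (D : Digon G v u) where
  open Digon D

  digon-loop-degree : v ≡ u → 4 ≤ deg G v
  digon-loop-degree refl = length≤degIn G (λ _ → true) v
    ((e , i) ∷ (e , opp i) ∷ (f , j) ∷ (f , opp j) ∷ [])
    (((opp-≢ i ∘ cong proj₂) ∷ (e≢f ∘ cong proj₁) ∷ (e≢f ∘ cong proj₁) ∷ []) ∷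
     ((e≢f ∘ cong proj₁) ∷ (e≢f ∘ cong proj₁) ∷ []) ∷
     ((opp-≢ j ∘ cong proj₂) ∷ []) ∷ [] ∷ [])
    ((refl , e-v) ∷ (refl , e-u) ∷ (refl , f-v) ∷ (refl , f-u) ∷ [])

  digon-saturated : (S : Edge G → Bool) → degIn G S v ≡ deg G v → 2 ≤ degIn G S u
  digon-saturated S saturated = length≤degIn G S u ((e , opp i) ∷ (f , opp j) ∷ [])
    (((e≢f ∘ cong proj₁) ∷ []) ∷ [] ∷ [])
    ((saturated-contains G S saturated e-v , e-u) ∷ (saturated-contains G S saturated f-v , f-u) ∷ [])

2*k+d≡3⇒d≡1∨d≡3 : ∀ k d → 2 * k + d ≡ 3 → d ≡ 1 ⊎ d ≡ 3
2*k+d≡3⇒d≡1∨d≡3 zero d eq = inj₂ eq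
2*k+d≡3⇒d≡1∨d≡3 (suc zero) d eq = inj₁ (suc-injective (suc-injective eq))
2*k+d≡3⇒d≡1∨d≡3 (suc (suc k)) d eq =
  contradiction (subst (4 ≤_) eq (≤-trans (*-monoʳ-≤ 2 (s≤s (s≤s z≤n))) (m≤m+n (2 * suc (suc k)) d))) 1+n≰n

count-pairs : ∀ a b c → count (λ x → x) (a ∷ a ∷ b ∷ b ∷ c ∷ c ∷ []) ≡ 2 * (bit a + bit b + bit c)
count-pairs true  true  true  = refl
count-pairs true  true  false = refl
count-pairs true  false true  = refl
count-pairs true  false false = refl
count-pairs false true  true  = refl
count-pairs false true  false = refl
count-pairs false false true  = refl
count-pairs false false false = refl

module _ (G : Graph) (v : Vtx G) where
  open Inflate G v

  restrict : (Edge (inflate G v) → Bool) → Edge G → Bool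
  restrict M e = M (3 ↑ʳ e)

  t≢old : ∀ {x} → x ≢ v → ∀ r → does (t r ≟F old x) ≡ false
  t≢old x≢v 0 = dec-false (v ≟F _) (x≢v ∘ sym)
  t≢old x≢v 1 = refl
  t≢old x≢v (suc (suc r)) = refl

  end-inflate≟old : ∀ {x} → x ≢ v → ∀ {y} (y≟v : Dec (y ≡ v)) r →
    does ((if does y≟v then t r else old y) ≟F old x) ≡ does (y ≟F x)
  end-inflate≟old x≢v (yes refl) r = trans (t≢old x≢v r) (sym (dec-false (v ≟F _) (x≢v ∘ sym)))
  end-inflate≟old x≢v (no _) r = refl

  inTriangle : Fin N → Bool
  inTriangle zero = true
  inTriangle (suc zero) = true
  inTriangle (suc (suc y)) = does (y ≟F v)

  inTriangle-sum : ∀ b y → bit (b ∧ does (y ≟F t 0)) + bit (b ∧ does (y ≟F t 1)) + bit (b ∧ does (y ≟F t 2))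
                           ≡ bit (b ∧ inTriangle y)
  inTriangle-sum false y = refl
  inTriangle-sum true zero = refl
  inTriangle-sum true (suc zero) = refl
  inTriangle-sum true (suc (suc y)) with does (y ≟F v)
  ... | true = refl
  ... | false = refl

  inTriangle-end : ∀ {y} (y≟v : Dec (y ≡ v)) r → inTriangle (if does y≟v then t r else old y) ≡ does y≟v
  inTriangle-end (yes refl) 0 = dec-true (v ≟F v) refl
  inTriangle-end (yes refl) 1 = refl
  inTriangle-end (yes refl) (suc (suc r)) = refl
  inTriangle-end {y} (no y≢v) r = dec-false (y ≟F v) y≢v

  module _ (M : Edge (inflate G v) → Bool) where

    ends-at : Fin N → Fin (3 + m G) × Fin 2 → Bool
    ends-at y d = M (proj₁ d) ∧ does (end' (proj₁ d) (proj₂ d) ≟F y)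

    degIn-inflate-old : ∀ {x} → x ≢ v → degIn (inflate G v) M (old x) ≡ degIn G (restrict M) x
    degIn-inflate-old {x} x≢v =
      trans (count-darts-+ 3 (m G) (ends-at (old x))) (cong₂ _+_ triangle-darts old-darts)
      where
      triangle-darts : count (λ d → M (proj₁ d ↑ˡ m G) ∧ does (end' (proj₁ d ↑ˡ m G) (proj₂ d) ≟F old x))
                             (darts 3) ≡ 0
      triangle-darts rewrite dec-false (v ≟F x) (x≢v ∘ sym)
        | ∧-zeroʳ (M zero) | ∧-zeroʳ (M (suc zero)) | ∧-zeroʳ (M (suc (suc zero))) = refl
      old-darts : count (λ d → restrict M (proj₁ d) ∧ does (end' (3 ↑ʳ proj₁ d) (proj₂ d) ≟F old x)) (darts (m G))
                  ≡ degIn G (restrict M) x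
      old-darts = count-cong
        (λ (e , i) → cong (restrict M e ∧_) (end-inflate≟old x≢v (end G e i ≟F v) (rank e i))) (darts (m G))

    triangle-degree-sum : degIn (inflate G v) M (t 0) + degIn (inflate G v) M (t 1) + degIn (inflate G v) M (t 2)
      ≡ 2 * (bit (M zero) + bit (M (suc zero)) + bit (M (suc (suc zero)))) + degIn G (restrict M) v
    triangle-degree-sum =
      trans (count-+₃ {p = ends-at (t 0)} {ends-at (t 1)} {ends-at (t 2)}
                      (λ (e , i) → inTriangle-sum (M e) (end' e i)) (darts (3 + m G)))
            (trans (count-darts-+ 3 (m G) (λ (e , i) → M e ∧ inTriangle (end' e i)))
                   (cong₂ _+_ triangle-darts old-darts))
      where
      triangle-darts : count (λ d → M (proj₁ d ↑ˡ m G) ∧ inTriangle (end' (proj₁ d ↑ˡ m G) (proj₂ d))) (darts 3)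
                       ≡ 2 * (bit (M zero) + bit (M (suc zero)) + bit (M (suc (suc zero))))
      triangle-darts rewrite dec-true (v ≟F v) refl
        | ∧-identityʳ (M zero) | ∧-identityʳ (M (suc zero)) | ∧-identityʳ (M (suc (suc zero))) =
        count-pairs (M zero) (M (suc zero)) (M (suc (suc zero)))
      old-darts : count (λ d → restrict M (proj₁ d) ∧ inTriangle (end' (3 ↑ʳ proj₁ d) (proj₂ d))) (darts (m G))
                  ≡ degIn G (restrict M) v
      old-darts = count-cong
        (λ (e , i) → cong (restrict M e ∧_) (inTriangle-end (end G e i ≟F v) (rank e i))) (darts (m G))

    restrict-degree : PerfectMatching (inflate G v) M → degIn G (restrict M) v ≡ 1 ⊎ degIn G (restrict M) v ≡ 3
    restrict-degree pm = 2*k+d≡3⇒d≡1∨d≡3 (bit (M zero) + bit (M (suc zero)) + bit (M (suc (suc zero)))) _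
      (trans (sym triangle-degree-sum) (cong₂ _+_ (cong₂ _+_ (pm (t 0)) (pm (t 1))) (pm (t 2))))

    restrict-perfectMatching : PerfectMatching (inflate G v) M → degIn G (restrict M) v ≢ 3 →
      PerfectMatching G (restrict M)
    restrict-perfectMatching pm d≢3 x with x ≟F v
    ... | no x≢v = trans (sym (degIn-inflate-old x≢v)) (pm (old x))
    ... | yes refl with restrict-degree pm
    ...   | inj₁ d≡1 = d≡1
    ...   | inj₂ d≡3 = contradiction d≡3 d≢3

module _ {G : Graph} {v u : Vtx G} (cubic : Cubic G) (D : Digon G v u) where

  digon-restrict-perfectMatching : (M : Edge (inflate G v) → Bool) → PerfectMatching (inflate G v) M →
    PerfectMatching G (restrict G v M)
  digon-restrict-perfectMatching M pm = restrict-perfectMatching G v M pm λ d≡3 →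
    1+n≰n (subst (2 ≤_) u-degree-1 (digon-saturated D (restrict G v M) (trans d≡3 (sym (cubic v)))))
    where
    u≢v : u ≢ v
    u≢v u≡v = 1+n≰n (subst (4 ≤_) (cubic v) (digon-loop-degree D (sym u≡v)))
    u-degree-1 : degIn G (restrict G v M) u ≡ 1
    u-degree-1 = trans (sym (degIn-inflate-old G v M u≢v)) (pm (Inflate.old G v u))

  restrict-cover : ∀ {k} → Cover (inflate G v) k → Cover G k
  restrict-cover (Ms , pms , covers) =
    restrict G v ∘ Ms , (λ j → digon-restrict-perfectMatching (Ms j) (pms j)) , (λ e → covers (3 ↑ʳ e))

lemma6p5 : (G : Graph) → Snark G → PiAtLeast G 5 → (v : Vtx G) → Apex G v →
    ¬ (Σ (Edge G) λ e → Σ (Edge G) λ f → Parallel G e f × Incident G v e × Incident G v f)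
lemma6p5 G (cubic , _) π≥5 v (cover , _) (e , f , e∥f , v∈e , _) =
  π≥5 4 (n<1+n 4) (restrict-cover cubic (proj₂ (parallel⇒digon G e∥f v∈e)) cover)
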